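{- There is a constant $c > 0$ such that for every odd integer $n \ge 5$ there exists a finite set $S$ of words over $\{{\tt 0},{\tt 1}\}$, each of length at most $n$, such that $S^*$ is co-finite and the longest word in $\{{\tt 0},{\tt 1}\}^* \setminus S^*$ has length at least $c\, n^2 2^{n/2}$.
   Context: A language $L \subseteq \Sigma^*$ is co-finite if $\Sigma^* \setminus L$ is finite. -}

module Defs where

open import Data.Bool using (Bool)
open import Data.List using (List; []; _++_)
open import Data.List.Membership.Propositional using (_∈_)
open import Data.Nat using (ℕ)
open import Data.Integer using (+_)
open import Data.Rational using (ℚ; _/_)
open import Data.Product using (∃)
open import Relation.Nullary using (¬_)

-- Words over the binary alphabet {0,1} (false = 0, true = 1).
Word : Set
Word = List Bool

data Star (S : List Word) : Word → Set where
  nil  : Star S []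
  cons : ∀ {u w} → u ∈ S → Star S w → Star S (u ++ w)

CoFinite : (Word → Set) → Set
CoFinite L = ∃ λ (F : List Word) → ∀ w → ¬ L w → w ∈ F

ℕ→ℚ : ℕ → ℚ
ℕ→ℚ k = + k / 1

-- Write n = 2d + 1 and m = d + 1, and let S consist of all words of length m together with
-- the words of length n whose last d letters, read as a binary number, do not exceed their
-- first d letters. Cutting a word into blocks of length m, the d-bit numbers leading the
-- blocks must increase until a non-ascending window of length n appears, which happens
-- within 2^d blocks; such a window shifts the length by -1 modulo m, so every long word
-- lies in S*. Conversely, list the d-bit numbers 0, 1, …, 2^d - 1 separated by 0, pad with
-- 0^m, repeat this d - 1 times and append one more listing: at block boundaries all windows
-- ascend, and tracking the cut positions modulo m shows that no factorisation over S ends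
-- at the end of this word, whose length is of order d² 2^d, i.e. n² 2^(n/2).
module Submission where

open import Defs
open import Data.Nat using (ℕ; _≤_; _^_; _*_; _%_)
open import Relation.Binary.PropositionalEquality using (_≡_)
open import Data.List using (List; length)
open import Data.List.Relation.Unary.All using (All)
open import Data.Product using (∃; _×_)
open import Data.Rational using (ℚ; Positive) renaming (_≤_ to _≤ℚ_; _*_ to _*ℚ_)
open import Relation.Nullary using (¬_)

open import Data.Bool using (Bool; true; false)
open import Data.Integer as ℤ using (+≤+)
import Data.Integer.Properties as ℤ
open import Data.List
  using ([]; _∷_; _++_; replicate; take; drop; filter; upTo; concatMap; cartesianProductWith)
open import Data.List.Membership.Propositional using (_∈_; lose)
open import Data.List.Membership.Propositional.Properties
  using ( ∈-++⁺ˡ; ∈-++⁺ʳ; ∈-++⁻; ∈-filter⁺; ∈-filter⁻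
        ; ∈-cartesianProductWith⁺; ∈-cartesianProductWith⁻; ∈-concatMap⁺; ∈-upTo⁺)
open import Data.List.Properties
  using ( ++-assoc; ++-identityʳ; length-++; length-replicate; length-take; length-drop
        ; take-take; take-drop; drop-drop; take++drop≡id)
open import Data.List.Relation.Unary.All using (tabulate)
open import Data.List.Relation.Unary.Any using (here; there)
open import Data.Nat using (zero; suc; _+_; _∸_; _<_; z≤n; s≤s; _≤?_; _/_; ⌊_/2⌋)
open import Data.Nat.DivMod using (m≡m%n+[m/n]*n)
open import Data.Nat.Divisibility using (_∣_; _∣0; divides; ∣-refl; ∣m+n∣m⇒∣n; ∣m∣n⇒∣m+n)
open import Data.Nat.Properties
open import Data.Nat.Tactic.RingSolver using (solve-∀)
open import Data.Product using (_,_; ∃₂)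
open import Data.Rational using (toℚᵘ)
open import Data.Rational.Properties using (toℚᵘ-cancel-≤; toℚᵘ-homo-*; toℚᵘ-fromℚᵘ)
open import Data.Rational.Unnormalised as ℚᵘ using (mkℚᵘ; *≤*)
import Data.Rational.Unnormalised.Properties as ℚᵘ
open import Data.Sum using (_⊎_; inj₁; inj₂; [_,_]′)
open import Relation.Binary.PropositionalEquality
  using (refl; sym; trans; cong; cong₂; subst; subst₂; module ≡-Reasoning)
open import Relation.Nullary using (yes; no; contradiction)
open import Relation.Unary using (Decidable)

module _ {A : Set} where

  take-++ˡ : ∀ (xs ys : List A) → take (length xs) (xs ++ ys) ≡ xs
  take-++ˡ []       ys = refl
  take-++ˡ (x ∷ xs) ys = cong (x ∷_) (take-++ˡ xs ys)

  drop-++ˡ : ∀ (xs ys : List A) → drop (length xs) (xs ++ ys) ≡ ys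
  drop-++ˡ []       ys = refl
  drop-++ˡ (x ∷ xs) ys = drop-++ˡ xs ys

  drop-suc-++ : ∀ (xs : List A) y ys → drop (suc (length xs)) (xs ++ y ∷ ys) ≡ ys
  drop-suc-++ []       y ys = refl
  drop-suc-++ (x ∷ xs) y ys = drop-suc-++ xs y ys

  length-take-≤ : ∀ k (xs : List A) → k ≤ length xs → length (take k xs) ≡ k
  length-take-≤ k xs k≤ = trans (length-take k xs) (m≤n⇒m⊓n≡m k≤)

  repeat : ℕ → List A → List A
  repeat zero    xs = []
  repeat (suc k) xs = xs ++ repeat k xs

  length-repeat : ∀ k (xs : List A) → length (repeat k xs) ≡ k * length xs
  length-repeat zero    xs = refl
  length-repeat (suc k) xs = trans (length-++ xs) (cong (length xs +_) (length-repeat k xs))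

  drop-repeat : ∀ k r (xs ys : List A) → drop (k * length xs) (repeat (k + r) xs ++ ys) ≡ repeat r xs ++ ys
  drop-repeat zero    r xs ys = refl
  drop-repeat (suc k) r xs ys = begin
    drop (length xs + k * length xs) ((xs ++ repeat (k + r) xs) ++ ys)
      ≡⟨ sym (drop-drop (length xs) (k * length xs) _) ⟩
    drop (k * length xs) (drop (length xs) ((xs ++ repeat (k + r) xs) ++ ys))
      ≡⟨ cong (λ zs → drop (k * length xs) (drop (length xs) zs)) (++-assoc xs _ ys) ⟩
    drop (k * length xs) (drop (length xs) (xs ++ (repeat (k + r) xs ++ ys)))
      ≡⟨ cong (drop (k * length xs)) (drop-++ˡ xs _) ⟩
    drop (k * length xs) (repeat (k + r) xs ++ ys)
      ≡⟨ drop-repeat k r xs ys ⟩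
    repeat r xs ++ ys ∎
    where open ≡-Reasoning

  repeat-++-prefix : ∀ r (xs ys : List A) → ∃ λ zs → repeat r (xs ++ ys) ++ xs ≡ xs ++ zs
  repeat-++-prefix zero    xs ys = [] , sym (++-identityʳ xs)
  repeat-++-prefix (suc r) xs ys =
    ys ++ repeat r (xs ++ ys) ++ xs ,
    trans (++-assoc (xs ++ ys) _ xs) (++-assoc xs ys _)

bit : Bool → ℕ
bit false = 0
bit true  = 1

-- Little-endian: the first letter is the least significant bit.
value : Word → ℕ
value []      = 0
value (b ∷ u) = bit b + 2 * value u

value<2^length : ∀ u → value u < 2 ^ length u
value<2^length []      = s≤s z≤n
value<2^length (b ∷ u) = begin-strict
  bit b + 2 * value u  <⟨ s≤s (+-monoˡ-≤ (2 * value u) (bit≤1 b)) ⟩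
  2 + 2 * value u      ≡⟨ sym (*-suc 2 (value u)) ⟩
  2 * suc (value u)    ≤⟨ *-monoʳ-≤ 2 (value<2^length u) ⟩
  2 * 2 ^ length u     ∎
  where
  open ≤-Reasoning
  bit≤1 : ∀ b → bit b ≤ 1
  bit≤1 false = z≤n
  bit≤1 true  = s≤s z≤n

lowBit : ℕ → Bool
lowBit zero          = false
lowBit (suc zero)    = true
lowBit (suc (suc i)) = lowBit i

bit-lowBit+2*⌊/2⌋ : ∀ i → bit (lowBit i) + 2 * ⌊ i /2⌋ ≡ i
bit-lowBit+2*⌊/2⌋ zero          = refl
bit-lowBit+2*⌊/2⌋ (suc zero)    = refl
bit-lowBit+2*⌊/2⌋ (suc (suc i)) =
  trans (shift (bit (lowBit i)) ⌊ i /2⌋) (cong (λ k → suc (suc k)) (bit-lowBit+2*⌊/2⌋ i))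
  where
  shift : ∀ b h → b + 2 * suc h ≡ suc (suc (b + 2 * h))
  shift = solve-∀

binary : ℕ → ℕ → Word
binary zero    i = []
binary (suc k) i = lowBit i ∷ binary k ⌊ i /2⌋

length-binary : ∀ k i → length (binary k i) ≡ k
length-binary zero    i = refl
length-binary (suc k) i = cong suc (length-binary k ⌊ i /2⌋)

value-binary : ∀ k i → i < 2 ^ k → value (binary k i) ≡ i
value-binary zero    i i<1 = sym (n<1⇒n≡0 i<1)
value-binary (suc k) i i<2^k+1 =
  trans (cong (λ v → bit (lowBit i) + 2 * v) (value-binary k ⌊ i /2⌋ ⌊i/2⌋<2^k))
        (bit-lowBit+2*⌊/2⌋ i)
  where
  ⌊i/2⌋<2^k : ⌊ i /2⌋ < 2 ^ k
  ⌊i/2⌋<2^k = *-cancelˡ-< 2 ⌊ i /2⌋ (2 ^ k) (begin-strict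
    2 * ⌊ i /2⌋                   ≤⟨ m≤n+m (2 * ⌊ i /2⌋) (bit (lowBit i)) ⟩
    bit (lowBit i) + 2 * ⌊ i /2⌋  ≡⟨ bit-lowBit+2*⌊/2⌋ i ⟩
    i                             <⟨ i<2^k+1 ⟩
    2 * 2 ^ k                     ∎)
    where open ≤-Reasoning

words : ℕ → List Word
words zero    = [] ∷ []
words (suc k) = cartesianProductWith _∷_ (true ∷ false ∷ []) (words k)

∈-words : ∀ u → u ∈ words (length u)
∈-words []      = here refl
∈-words (b ∷ u) = ∈-cartesianProductWith⁺ _∷_ (∈-bools b) (∈-words u)
  where
  ∈-bools : ∀ b → b ∈ true ∷ false ∷ []
  ∈-bools true  = here refl
  ∈-bools false = there (here refl)

∈-words⁻ : ∀ k {u} → u ∈ words k → length u ≡ k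
∈-words⁻ zero (here refl) = refl
∈-words⁻ (suc k) u∈ with ∈-cartesianProductWith⁻ _∷_ (true ∷ false ∷ []) (words k) u∈
... | _ , u , _ , u∈words , refl = cong suc (∈-words⁻ k u∈words)

cofinite-if-long : ∀ (L : Word → Set) B → (∀ u → B ≤ length u → L u) → CoFinite L
cofinite-if-long L B long = concatMap words (upTo B) , short
  where
  short : ∀ u → ¬ L u → u ∈ concatMap words (upTo B)
  short u ¬Lu with B ≤? length u
  ... | yes B≤ = contradiction (long u B≤) ¬Lu
  ... | no  B≰ = ∈-concatMap⁺ words (lose (∈-upTo⁺ (≰⇒> B≰)) (∈-words u))

module _ {S : List Word} where

  star-++ : ∀ {u v} → Star S u → Star S v → Star S (u ++ v)
  star-++ nil v∈S* = v∈S*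
  star-++ {v = v} (cons {u} {w} u∈S w∈S*) v∈S* =
    subst (Star S) (sym (++-assoc u w v)) (cons u∈S (star-++ w∈S* v∈S*))

  star-of-multiple : ∀ m → (∀ u → length u ≡ m → u ∈ S) → ∀ v → m ∣ length v → Star S v
  star-of-multiple m S⊇m-words v (divides q len≡q*m) = go q v len≡q*m
    where
    go : ∀ q v → length v ≡ q * m → Star S v
    go zero    [] _    = nil
    go (suc q) v  len≡ =
      subst (Star S) (take++drop≡id m v)
        (cons (S⊇m-words (take m v) (length-take-≤ m v m≤len))
              (go q (drop m v) (trans (length-drop m v) (trans (cong (_∸ m) len≡) (m+n∸m≡n m (q * m))))))
      where
      m≤len : m ≤ length v
      m≤len = subst (m ≤_) (sym len≡) (m≤m+n m (q * m))

distance-to-multiple : ∀ d x → ∃ λ j → j ≤ d × suc d ∣ x + j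
distance-to-multiple d zero = 0 , z≤n , suc d ∣0
distance-to-multiple d (suc x) with distance-to-multiple d x
... | suc j , sj≤d , ∣x+sj = j , ≤-trans (n≤1+n j) sj≤d , subst (suc d ∣_) (+-suc x j) ∣x+sj
... | zero  , _    , ∣x+0  = d , ≤-refl ,
  subst (suc d ∣_) (trans (cong (_+ suc d) (+-identityʳ x)) (+-suc x d)) (∣m∣n⇒∣m+n ∣x+0 ∣-refl)

module Construction (c : ℕ) where

  d m n N : ℕ
  d = suc c
  m = suc d
  n = m + d
  N = 2 ^ d

  suc-n≡2*m : suc n ≡ 2 * m
  suc-n≡2*m = identity d
    where
    identity : ∀ d → suc (suc d + d) ≡ 2 * suc d
    identity = solve-∀

  NonAscending : Word → Set
  NonAscending u = value (drop m u) ≤ value (take d u)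

  nonAscending? : Decidable NonAscending
  nonAscending? u = value (drop m u) ≤? value (take d u)

  S : List Word
  S = words m ++ filter nonAscending? (words n)

  ∈S-of-length-m : ∀ u → length u ≡ m → u ∈ S
  ∈S-of-length-m u len≡m = ∈-++⁺ˡ (subst (λ k → u ∈ words k) len≡m (∈-words u))

  ∈S-of-length-n : ∀ u → length u ≡ n → NonAscending u → u ∈ S
  ∈S-of-length-n u len≡n u↘ =
    ∈-++⁺ʳ (words m) (∈-filter⁺ nonAscending? (subst (λ k → u ∈ words k) len≡n (∈-words u)) u↘)

  ∈S⁻ : ∀ {u} → u ∈ S → length u ≡ m ⊎ (length u ≡ n × NonAscending u)
  ∈S⁻ {u} u∈S with ∈-++⁻ (words m) u∈S
  ... | inj₁ u∈words = inj₁ (∈-words⁻ m u∈words)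
  ... | inj₂ u∈filter with ∈-filter⁻ nonAscending? u∈filter
  ...   | u∈words , u↘ = inj₂ (∈-words⁻ n u∈words , u↘)

  S-lengths≤n : All (λ u → length u ≤ n) S
  S-lengths≤n = tabulate λ u∈S → [ (λ len≡m → ≤-trans (≤-reflexive len≡m) (m≤m+n m d))
                                 , (λ (len≡n , _) → ≤-reflexive len≡n) ]′ (∈S⁻ u∈S)

  leading : Word → ℕ
  leading v = value (take d v)

  leading<N : ∀ v → leading v < N
  leading<N v = <-≤-trans (value<2^length (take d v))
    (^-monoʳ-≤ 2 (≤-trans (≤-reflexive (length-take d v)) (m⊓n≤m d (length v))))

  leading-increases : ∀ v → ¬ NonAscending (take n v) → leading v < leading (drop m v)
  leading-increases v ¬v↘ = subst₂ (λ a b → value a < value b) first-half second-half (≰⇒> ¬v↘)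
    where
    first-half : take d (take n v) ≡ take d v
    first-half = trans (take-take d n v) (cong (λ k → take k v) (m≤n⇒m⊓n≡m (m≤n+m d m)))
    second-half : drop m (take n v) ≡ take d (drop m v)
    second-half = sym (take-drop d m v)

  star-singleton : ∀ {u} → u ∈ S → Star S u
  star-singleton {u} u∈S = subst (Star S) (++-identityʳ u) (cons u∈S nil)

  -- Reading v in blocks of length m, the leading values strictly increase until a
  -- non-ascending window of length n = 2m - 1 appears; as they stay below N, one appears
  -- within t blocks as soon as N ≤ leading v + t.
  climb : ∀ t v → N ≤ leading v + t → t * m + n ≤ length v →
          ∃₂ λ x rest → v ≡ x ++ rest × Star S x × length x ≤ t * m + n × m ∣ suc (length x)
  climb zero    v N≤ _ = contradiction (subst (N ≤_) (+-identityʳ (leading v)) N≤) (<⇒≱ (leading<N v))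
  climb (suc t) v N≤ len≥ with nonAscending? (take n v)
  ... | yes v↘ =
    take n v , drop n v , sym (take++drop≡id n v) , star-singleton (∈S-of-length-n _ len≡n v↘) ,
    ≤-trans (≤-reflexive len≡n) (m≤n+m n (suc t * m)) ,
    divides 2 (trans (cong suc len≡n) suc-n≡2*m)
    where
    len≡n : length (take n v) ≡ n
    len≡n = length-take-≤ n v (≤-trans (m≤n+m n (suc t * m)) len≥)
  ... | no ¬v↘ with climb t (drop m v) N≤′ len≥′
    where
    N≤′ : N ≤ leading (drop m v) + t
    N≤′ = ≤-trans N≤ (≤-trans (≤-reflexive (+-suc (leading v) t))
                               (+-monoˡ-≤ t (leading-increases v ¬v↘)))
    len≥′ : t * m + n ≤ length (drop m v)
    len≥′ = begin
      t * m + n              ≡⟨ sym (m+n∸m≡n m (t * m + n)) ⟩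
      m + (t * m + n) ∸ m    ≡⟨ cong (_∸ m) (sym (+-assoc m (t * m) n)) ⟩
      suc t * m + n ∸ m      ≤⟨ ∸-monoˡ-≤ m len≥ ⟩
      length v ∸ m           ≡⟨ sym (length-drop m v) ⟩
      length (drop m v)      ∎
      where open ≤-Reasoning
  ... | x , rest , drop≡x++rest , x∈S* , len-x≤ , m∣1+len-x =
    take m v ++ x , rest , v≡ , cons (∈S-of-length-m _ len-block) x∈S* , len≤ ,
    subst (m ∣_) (sym 1+len≡) (∣m∣n⇒∣m+n ∣-refl m∣1+len-x)
    where
    len-block : length (take m v) ≡ m
    len-block = length-take-≤ m v (≤-trans (m≤m+n m (t * m + n)) (≤-trans (≤-reflexive (sym (+-assoc m (t * m) n))) len≥))
    1+len≡ : suc (length (take m v ++ x)) ≡ m + suc (length x)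
    1+len≡ = trans (cong suc (length-++ (take m v)))
                   (trans (sym (+-suc (length (take m v)) (length x))) (cong (_+ suc (length x)) len-block))
    v≡ : v ≡ (take m v ++ x) ++ rest
    v≡ = begin
      v                          ≡⟨ sym (take++drop≡id m v) ⟩
      take m v ++ drop m v       ≡⟨ cong (take m v ++_) drop≡x++rest ⟩
      take m v ++ (x ++ rest)    ≡⟨ sym (++-assoc (take m v) x rest) ⟩
      (take m v ++ x) ++ rest    ∎
      where open ≡-Reasoning
    len≤ : length (take m v ++ x) ≤ suc t * m + n
    len≤ = begin
      length (take m v ++ x)     ≡⟨ length-++ (take m v) ⟩
      length (take m v) + length x ≡⟨ cong (_+ length x) len-block ⟩
      m + length x               ≤⟨ +-monoʳ-≤ m len-x≤ ⟩
      m + (t * m + n)            ≡⟨ sym (+-assoc m (t * m) n) ⟩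
      suc t * m + n              ∎
      where open ≤-Reasoning

  K : ℕ
  K = N * m + n

  -- Each climb consumes a factor of length ≡ -1 (mod m), so j climbs absorb a deficit of j.
  star-of-long : ∀ j v → m ∣ length v + j → j * K ≤ length v → Star S v
  star-of-long zero v m∣ _ = star-of-multiple m ∈S-of-length-m v (subst (m ∣_) (+-identityʳ (length v)) m∣)
  star-of-long (suc j) v m∣ len≥
    with climb N v (m≤n+m N (leading v)) (≤-trans (m≤m+n K (j * K)) len≥)
  ... | x , rest , refl , x∈S* , len-x≤K , m∣1+len-x = star-++ x∈S* (star-of-long j rest m∣′ len≥′)
    where
    m∣′ : m ∣ length rest + j
    m∣′ = ∣m+n∣m⇒∣n (subst (m ∣_) (regroup (length x) (length rest) j)
                     (subst (λ l → m ∣ l + suc j) (length-++ x) m∣)) m∣1+len-x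
      where
      regroup : ∀ a b j → a + b + suc j ≡ suc a + (b + j)
      regroup = solve-∀
    len≥′ : j * K ≤ length rest
    len≥′ = +-cancelˡ-≤ K (j * K) (length rest)
      (≤-trans len≥ (≤-trans (≤-reflexive (length-++ x)) (+-monoˡ-≤ (length rest) len-x≤K)))

  star-cofinite : CoFinite (Star S)
  star-cofinite = cofinite-if-long (Star S) (d * K) λ v len≥ →
    let (j , j≤d , m∣) = distance-to-multiple d (length v)
    in  star-of-long j v m∣ (≤-trans (*-monoˡ-≤ K j≤d) len≥)

  top : ℕ
  top = N ∸ 1

  suc-top : suc top ≡ N
  suc-top = m+[n∸m]≡n (m^n>0 2 d)

  countFrom : ℕ → ℕ → Word
  countFrom i zero    = binary d i
  countFrom i (suc r) = binary d i ++ false ∷ countFrom (suc i) r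

  window : ℕ → Word
  window i = binary d i ++ false ∷ binary d (suc i)

  period : Word
  period = countFrom 0 top ++ replicate m false

  witness : Word
  witness = repeat c period ++ countFrom 0 top

  T : ℕ
  T = length period

  length-countFrom : ∀ i r → length (countFrom i r) ≡ r * m + d
  length-countFrom i zero    = length-binary d i
  length-countFrom i (suc r) = begin
    length (binary d i ++ false ∷ countFrom (suc i) r)
      ≡⟨ length-++ (binary d i) ⟩
    length (binary d i) + suc (length (countFrom (suc i) r))
      ≡⟨ cong₂ (λ a b → a + suc b) (length-binary d i) (length-countFrom (suc i) r) ⟩
    d + suc (r * m + d)
      ≡⟨ regroup d (r * m) ⟩
    suc r * m + d ∎
    where
    open ≡-Reasoning
    regroup : ∀ d x → d + suc (x + d) ≡ suc d + x + d
    regroup = solve-∀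

  length-period : T ≡ top * m + d + m
  length-period = trans (length-++ (countFrom 0 top)) (cong₂ _+_ (length-countFrom 0 top) (length-replicate m))

  length-window : ∀ i → length (window i) ≡ n
  length-window i = begin
    length (binary d i ++ false ∷ binary d (suc i))
      ≡⟨ length-++ (binary d i) ⟩
    length (binary d i) + suc (length (binary d (suc i)))
      ≡⟨ cong₂ (λ a b → a + suc b) (length-binary d i) (length-binary d (suc i)) ⟩
    d + suc d
      ≡⟨ +-comm d m ⟩
    n ∎
    where open ≡-Reasoning

  window-ascends : ∀ i → suc i < N → ¬ NonAscending (window i)
  window-ascends i si<N window↘ = <-irrefl refl (begin-strict
    i                                   <⟨ n<1+n i ⟩
    suc i                               ≡⟨ sym (value-binary d (suc i) si<N) ⟩
    value (binary d (suc i))            ≡⟨ cong value (sym second-half) ⟩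
    value (drop m (window i))           ≤⟨ window↘ ⟩
    value (take d (window i))           ≡⟨ cong value first-half ⟩
    value (binary d i)                  ≡⟨ value-binary d i (<-trans (n<1+n i) si<N) ⟩
    i                                   ∎)
    where
    open ≤-Reasoning
    first-half : take d (window i) ≡ binary d i
    first-half = subst (λ k → take k (window i) ≡ binary d i) (length-binary d i) (take-++ˡ (binary d i) _)
    second-half : drop m (window i) ≡ binary d (suc i)
    second-half = subst (λ k → drop (suc k) (window i) ≡ binary d (suc i)) (length-binary d i)
                    (drop-suc-++ (binary d i) false _)

  countFrom-window : ∀ i r → ∃ λ Z → countFrom i (suc r) ≡ window i ++ Z
  countFrom-window i zero    = [] , sym (++-identityʳ (window i))
  countFrom-window i (suc r) = false ∷ countFrom (suc (suc i)) r , sym (++-assoc (binary d i) _ _)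

  drop-countFrom : ∀ q i r Z → drop (q * m) (countFrom i (q + r) ++ Z) ≡ countFrom (i + q) r ++ Z
  drop-countFrom zero    i r Z = cong (λ k → countFrom k r ++ Z) (sym (+-identityʳ i))
  drop-countFrom (suc q) i r Z = begin
    drop (m + q * m) ((binary d i ++ false ∷ countFrom (suc i) (q + r)) ++ Z)
      ≡⟨ sym (drop-drop m (q * m) ((binary d i ++ false ∷ countFrom (suc i) (q + r)) ++ Z)) ⟩
    drop (q * m) (drop m ((binary d i ++ false ∷ countFrom (suc i) (q + r)) ++ Z))
      ≡⟨ cong (λ zs → drop (q * m) (drop m zs)) (++-assoc (binary d i) _ Z) ⟩
    drop (q * m) (drop m (binary d i ++ false ∷ (countFrom (suc i) (q + r) ++ Z)))
      ≡⟨ cong (drop (q * m)) (drop-block i _) ⟩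
    drop (q * m) (countFrom (suc i) (q + r) ++ Z)
      ≡⟨ drop-countFrom q (suc i) r Z ⟩
    countFrom (suc i + q) r ++ Z
      ≡⟨ cong (λ k → countFrom k r ++ Z) (sym (+-suc i q)) ⟩
    countFrom (i + suc q) r ++ Z ∎
    where
    open ≡-Reasoning
    drop-block : ∀ i xs → drop m (binary d i ++ false ∷ xs) ≡ xs
    drop-block i xs = subst (λ k → drop (suc k) (binary d i ++ false ∷ xs) ≡ xs) (length-binary d i)
                        (drop-suc-++ (binary d i) false xs)

  T≡d+N*m : T ≡ d + N * m
  T≡d+N*m = begin
    T                    ≡⟨ length-period ⟩
    top * m + d + m      ≡⟨ regroup top c ⟩
    d + suc top * m      ≡⟨ cong (λ k → d + k * m) suc-top ⟩
    d + N * m            ∎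
    where
    open ≡-Reasoning
    regroup : ∀ top c → top * suc (suc c) + suc c + suc (suc c) ≡ suc c + suc top * suc (suc c)
    regroup = solve-∀

  window-in-witness : ∀ {ε q} → ε ≤ c → suc q < N → take n (drop (ε * T + q * m) witness) ≡ window q
  window-in-witness {ε} {q} ε≤c 1+q<N
    with m≤n⇒∃[o]m+o≡n ε≤c | m≤n⇒∃[o]m+o≡n (≤-pred (subst (suc q <_) (sym suc-top) 1+q<N))
  ... | r , ε+r≡c | s , 1+q+s≡top
    with repeat-++-prefix r (countFrom 0 top) (replicate m false) | countFrom-window q s
  ... | Z₁ , period-prefix | Z₂ , window-prefix = begin
    take n (drop (ε * T + q * m) witness)
      ≡⟨ cong (take n) (sym (drop-drop (ε * T) (q * m) witness)) ⟩
    take n (drop (q * m) (drop (ε * T) (repeat c period ++ countFrom 0 top)))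
      ≡⟨ cong (λ k → take n (drop (q * m) (drop (ε * T) (repeat k period ++ countFrom 0 top)))) (sym ε+r≡c) ⟩
    take n (drop (q * m) (drop (ε * T) (repeat (ε + r) period ++ countFrom 0 top)))
      ≡⟨ cong (λ zs → take n (drop (q * m) zs)) (trans (drop-repeat ε r period _) period-prefix) ⟩
    take n (drop (q * m) (countFrom 0 top ++ Z₁))
      ≡⟨ cong (λ k → take n (drop (q * m) (countFrom 0 k ++ Z₁))) (sym (trans (+-suc q s) 1+q+s≡top)) ⟩
    take n (drop (q * m) (countFrom 0 (q + suc s) ++ Z₁))
      ≡⟨ cong (take n) (drop-countFrom q 0 (suc s) Z₁) ⟩
    take n (countFrom q (suc s) ++ Z₁)
      ≡⟨ cong (λ zs → take n (zs ++ Z₁)) window-prefix ⟩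
    take n ((window q ++ Z₂) ++ Z₁)
      ≡⟨ cong (take n) (++-assoc (window q) Z₂ Z₁) ⟩
    take n (window q ++ (Z₂ ++ Z₁))
      ≡⟨ subst (λ k → take k (window q ++ (Z₂ ++ Z₁)) ≡ window q) (length-window q) (take-++ˡ (window q) _) ⟩
    window q ∎
    where open ≡-Reasoning

  -- The positions at which a factorisation of the witness over S can cut: p falls short of
  -- blocks · m by lag ≤ d, and, as suc T = (N + 1) · m, lag is at most the number of
  -- complete periods before p.
  record Admissible (p : ℕ) : Set where
    constructor admissible
    field
      lag blocks : ℕ
      lag≤d      : lag ≤ d
      lag-bound  : lag * suc N ≤ blocks
      aligned    : p + lag ≡ blocks * m

  admissible-+m : ∀ {p} → Admissible p → Admissible (p + m)
  admissible-+m {p} (admissible ε j ε≤d bound aligned) =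
    admissible ε (suc j) ε≤d (≤-trans bound (n≤1+n j)) (begin
      p + m + ε      ≡⟨ regroup p m ε ⟩
      m + (p + ε)    ≡⟨ cong (m +_) aligned ⟩
      suc j * m      ∎)
    where
    open ≡-Reasoning
    regroup : ∀ p m ε → p + m + ε ≡ m + (p + ε)
    regroup = solve-∀

  position-in-period : ∀ {p ε q} → p + ε ≡ (ε * suc N + q) * m → p ≡ ε * T + q * m
  position-in-period {p} {ε} {q} aligned = +-cancelʳ-≡ ε p (ε * T + q * m) (begin
    p + ε                        ≡⟨ aligned ⟩
    (ε * suc N + q) * m          ≡⟨ distribute ε (suc N) q m ⟩
    ε * (suc N * m) + q * m      ≡⟨ cong (λ k → ε * suc k + q * m) (sym T≡d+N*m) ⟩
    ε * suc T + q * m            ≡⟨ regroup ε T (q * m) ⟩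
    ε * T + q * m + ε            ∎)
    where
    open ≡-Reasoning
    distribute : ∀ e s q m → (e * s + q) * m ≡ e * (s * m) + q * m
    distribute = solve-∀
    regroup : ∀ e t x → e * suc t + x ≡ e * t + x + e
    regroup = solve-∀

  stalled-inside-period : ∀ {ε q} → suc (suc (ε * suc N + q)) < suc ε * suc N → suc q < N
  stalled-inside-period {ε} {q} overflow = ≤-pred (+-cancelˡ-< (ε * suc N) (suc (suc q)) (suc N)
    (subst₂ _<_ (sym (trans (+-suc (ε * suc N) (suc q)) (cong suc (+-suc (ε * suc N) q))))
                (+-comm (suc N) (ε * suc N)) overflow))

  -- A non-ascending factor of length n either wraps the lag around from d to 0, or raises
  -- it by one, which the lag bound forbids inside a period, where every window ascends.
  admissible-+n : ∀ {p} → Admissible p → NonAscending (take n (drop p witness)) → Admissible (p + n)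
  admissible-+n {p} (admissible ε j ε≤d bound aligned) p↘ with m≤n⇒m<n∨m≡n ε≤d
  ... | inj₂ refl = admissible 0 (suc j) z≤n z≤n (begin
      p + n + 0      ≡⟨ regroup p m d ⟩
      m + (p + d)    ≡⟨ cong (m +_) aligned ⟩
      suc j * m      ∎)
    where
    open ≡-Reasoning
    regroup : ∀ p m d → p + (m + d) + 0 ≡ m + (p + d)
    regroup = solve-∀
  ... | inj₁ ε<d with suc ε * suc N ≤? suc (suc j)
  ...   | yes bound′ = admissible (suc ε) (suc (suc j)) ε<d bound′ (begin
      p + n + suc ε        ≡⟨ regroup p n ε ⟩
      p + ε + suc n        ≡⟨ cong₂ _+_ aligned suc-n≡2*m ⟩
      j * m + 2 * m        ≡⟨ two-more j m ⟩
      suc (suc j) * m      ∎)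
    where
    open ≡-Reasoning
    regroup : ∀ p n ε → p + n + suc ε ≡ p + ε + suc n
    regroup = solve-∀
    two-more : ∀ j m → j * m + 2 * m ≡ suc (suc j) * m
    two-more = solve-∀
  ...   | no ¬bound′ with m≤n⇒∃[o]m+o≡n bound
  ...     | q , refl = contradiction (subst NonAscending at-window p↘) (window-ascends q 1+q<N)
    where
    1+q<N : suc q < N
    1+q<N = stalled-inside-period {ε} {q} (≰⇒> ¬bound′)
    at-window : take n (drop p witness) ≡ window q
    at-window = trans (cong (λ k → take n (drop k witness)) (position-in-period {p} {ε} {q} aligned))
                      (window-in-witness {ε} {q} (≤-pred ε<d) 1+q<N)

  admissible-+factor : ∀ {p u} → u ∈ S → u ≡ take (length u) (drop p witness) →
                       Admissible p → Admissible (p + length u)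
  admissible-+factor {p} {u} u∈S u≡ p-adm with ∈S⁻ u∈S
  ... | inj₁ len≡m = subst (λ k → Admissible (p + k)) (sym len≡m) (admissible-+m p-adm)
  ... | inj₂ (len≡n , u↘) = subst (λ k → Admissible (p + k)) (sym len≡n)
      (admissible-+n p-adm (subst NonAscending (trans u≡ (cong (λ k → take k (drop p witness)) len≡n)) u↘))

  admissible-end : ∀ {p v} → Star S v → v ≡ drop p witness → Admissible p → Admissible (p + length v)
  admissible-end {p} nil _ p-adm = subst Admissible (sym (+-identityʳ p)) p-adm
  admissible-end {p} (cons {u} {v} u∈S v∈S*) u++v≡ p-adm =
    subst Admissible (trans (+-assoc p (length u) (length v)) (cong (p +_) (sym (length-++ u))))
      (admissible-end v∈S* v≡ (admissible-+factor u∈S u≡ p-adm))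
    where
    u≡ : u ≡ take (length u) (drop p witness)
    u≡ = trans (sym (take-++ˡ u v)) (cong (take (length u)) u++v≡)
    v≡ : v ≡ drop (p + length u) witness
    v≡ = trans (sym (drop-++ˡ u v)) (trans (cong (drop (length u)) u++v≡) (drop-drop p (length u) witness))

  length-witness+d : length witness + d ≡ (c * suc N + N) * m
  length-witness+d = begin
    length witness + d
      ≡⟨ cong (_+ d) (length-++ (repeat c period)) ⟩
    length (repeat c period) + length (countFrom 0 top) + d
      ≡⟨ cong₂ (λ a b → a + b + d) (length-repeat c period) (length-countFrom 0 top) ⟩
    c * T + (top * m + d) + d
      ≡⟨ cong (λ t → c * t + (top * m + d) + d) T≡d+N*m ⟩
    c * (d + N * m) + (top * m + d) + d
      ≡⟨ cong (λ k → c * (d + k * m) + (top * m + d) + d) (sym suc-top) ⟩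
    c * (d + suc top * m) + (top * m + d) + d
      ≡⟨ regroup c top ⟩
    (c * suc (suc top) + suc top) * m
      ≡⟨ cong (λ k → (c * suc k + k) * m) suc-top ⟩
    (c * suc N + N) * m ∎
    where
    open ≡-Reasoning
    regroup : ∀ c top → let d = suc c; m = suc d in
      c * (d + suc top * m) + (top * m + d) + d ≡ (c * suc (suc top) + suc top) * m
    regroup = solve-∀

  -- The end of the witness is a multiple of m minus d, forcing the lag to be d; but only
  -- c = d - 1 periods precede it.
  ¬admissible-witness : ¬ Admissible (length witness)
  ¬admissible-witness (admissible ε j ε≤d bound aligned) =
    <⇒≱ A<d*sN (subst₂ (λ e k → e * suc N ≤ k) ε≡d j≡A bound)
    where
    L A : ℕ
    L = length witness
    A = c * suc N + N
    j*m≤A*m : j * m ≤ A * m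
    j*m≤A*m = begin
      j * m   ≡⟨ sym aligned ⟩
      L + ε   ≤⟨ +-monoʳ-≤ L ε≤d ⟩
      L + d   ≡⟨ length-witness+d ⟩
      A * m   ∎
      where open ≤-Reasoning
    A*m<1+j*m : A * m < suc j * m
    A*m<1+j*m = begin-strict
      A * m         ≡⟨ sym length-witness+d ⟩
      L + d         <⟨ +-monoʳ-< L (≤-trans (n<1+n d) (m≤n+m m ε)) ⟩
      L + (ε + m)   ≡⟨ sym (+-assoc L ε m) ⟩
      L + ε + m     ≡⟨ cong (_+ m) aligned ⟩
      j * m + m     ≡⟨ +-comm (j * m) m ⟩
      suc j * m     ∎
      where open ≤-Reasoning
    j≡A : j ≡ A
    j≡A = ≤-antisym (*-cancelʳ-≤ j A m j*m≤A*m) (≤-pred (*-cancelʳ-< m A (suc j) A*m<1+j*m))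
    ε≡d : ε ≡ d
    ε≡d = +-cancelˡ-≡ L ε d (trans aligned (trans (cong (_* m) j≡A) (sym length-witness+d)))
    A<d*sN : A < d * suc N
    A<d*sN = subst (A <_) (+-comm (c * suc N) (suc N)) (+-monoʳ-< (c * suc N) (n<1+n N))

  witness∉S* : ¬ Star S witness
  witness∉S* w∈S* = ¬admissible-witness (admissible-end w∈S* refl (admissible 0 0 z≤n z≤n refl))

  c*N*m≤length-witness : c * (N * m) ≤ length witness
  c*N*m≤length-witness = begin
    c * (N * m)                  ≤⟨ *-monoʳ-≤ c (m≤n+m (N * m) d) ⟩
    c * (d + N * m)              ≡⟨ cong (c *_) (sym T≡d+N*m) ⟩
    c * T                        ≡⟨ sym (length-repeat c period) ⟩
    length (repeat c period)     ≤⟨ m≤m+n _ (length (countFrom 0 top)) ⟩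
    length (repeat c period) + length (countFrom 0 top)
                                 ≡⟨ sym (length-++ (repeat c period)) ⟩
    length witness               ∎
    where open ≤-Reasoning

  2^n≡2*N*N : 2 ^ n ≡ 2 * (N * N)
  2^n≡2*N*N = cong (2 *_) (^-distribˡ-+-* 2 d d)

  n≤2*m : n ≤ 2 * m
  n≤2*m = +-monoʳ-≤ m (≤-trans (n≤1+n d) (≤-reflexive (sym (+-identityʳ m))))

  m≤3*c : 1 ≤ c → m ≤ 3 * c
  m≤3*c 1≤c = begin
    suc (suc c)   ≡⟨ regroup c ⟩
    c + 2 * 1     ≤⟨ +-monoʳ-≤ c (*-monoʳ-≤ 2 1≤c) ⟩
    c + 2 * c     ≡⟨ regroup′ c ⟩
    3 * c         ∎
    where
    open ≤-Reasoning
    regroup : ∀ c → suc (suc c) ≡ c + 2 * 1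
    regroup = solve-∀
    regroup′ : ∀ c → c + 2 * c ≡ 3 * c
    regroup′ = solve-∀

quartic-exponential-bound : ∀ {c m n N L} → n ≤ 2 * m → m ≤ 3 * c → c * (N * m) ≤ L →
                            n ^ 4 * (2 * (N * N)) ≤ 1024 * (L * L)
quartic-exponential-bound {c} {m} {n} {N} {L} n≤2m m≤3c cNm≤L = begin
  n ^ 4 * (2 * (N * N))                        ≤⟨ *-monoˡ-≤ (2 * (N * N)) (^-monoˡ-≤ 4 n≤2m) ⟩
  (2 * m) ^ 4 * (2 * (N * N))                  ≡⟨ regroup m N ⟩
  32 * (m * m) * (N * N) * (m * m)             ≤⟨ *-monoʳ-≤ (32 * (m * m) * (N * N)) (*-mono-≤ m≤3c m≤3c) ⟩
  32 * (m * m) * (N * N) * ((3 * c) * (3 * c)) ≡⟨ regroup′ m N c ⟩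
  288 * ((c * (N * m)) * (c * (N * m)))        ≤⟨ *-monoˡ-≤ ((c * (N * m)) * (c * (N * m))) (m≤m+n 288 736) ⟩
  1024 * ((c * (N * m)) * (c * (N * m)))       ≤⟨ *-monoʳ-≤ 1024 (*-mono-≤ cNm≤L cNm≤L) ⟩
  1024 * (L * L)                               ∎
  where
  open ≤-Reasoning
  regroup : ∀ m k → (2 * m) * ((2 * m) * ((2 * m) * ((2 * m) * 1))) * (2 * (k * k))
                  ≡ 32 * (m * m) * (k * k) * (m * m)
  regroup = solve-∀
  regroup′ : ∀ m k c → 32 * (m * m) * (k * k) * ((3 * c) * (3 * c))
                     ≡ 288 * ((c * (k * m)) * (c * (k * m)))
  regroup′ = solve-∀

odd-form : ∀ {n} h → n ≡ 1 + h * 2 → 5 ≤ n → ∃ λ e → n ≡ Construction.n (suc e)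
odd-form zero                refl (s≤s ())
odd-form (suc zero)          refl (s≤s (s≤s (s≤s ())))
odd-form (suc (suc e)) refl _ = e , regroup e
  where
  regroup : ∀ e → 1 + suc (suc e) * 2 ≡ suc (suc (suc e)) + suc (suc e)
  regroup = solve-∀

κ : ℚ
κ = ℤ.+ 1 Data.Rational./ 32

κ-positive : Positive κ
κ-positive = _

κ²-scaled-≤ : ∀ X Y → X ≤ 1024 * Y → (κ *ℚ κ) *ℚ ℕ→ℚ X ≤ℚ ℕ→ℚ Y
κ²-scaled-≤ X Y X≤1024Y = toℚᵘ-cancel-≤ (begin
  toℚᵘ ((κ *ℚ κ) *ℚ ℕ→ℚ X)
    ≃⟨ toℚᵘ-homo-* (κ *ℚ κ) (ℕ→ℚ X) ⟩
  toℚᵘ (κ *ℚ κ) ℚᵘ.* toℚᵘ (ℕ→ℚ X)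
    ≃⟨ ℚᵘ.*-congˡ {toℚᵘ (κ *ℚ κ)} (toℚᵘ-fromℚᵘ (mkℚᵘ (ℤ.+ X) 0)) ⟩
  mkℚᵘ (ℤ.+ 1) 1023 ℚᵘ.* mkℚᵘ (ℤ.+ X) 0
    ≤⟨ *≤* cross ⟩
  mkℚᵘ (ℤ.+ Y) 0
    ≃⟨ ℚᵘ.≃-sym (toℚᵘ-fromℚᵘ (mkℚᵘ (ℤ.+ Y) 0)) ⟩
  toℚᵘ (ℕ→ℚ Y) ∎)
  where
  open ℚᵘ.≤-Reasoning
  cross : (ℤ.+ 1 ℤ.* ℤ.+ X) ℤ.* ℤ.+ 1 ℤ.≤ ℤ.+ Y ℤ.* ℤ.+ 1024
  cross = subst₂ ℤ._≤_ (sym (trans (ℤ.*-identityʳ _) (ℤ.*-identityˡ (ℤ.+ X)))) (ℤ.pos-* Y 1024)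
            (+≤+ (subst (X ≤_) (*-comm 1024 Y) X≤1024Y))

CofiniteStarWithLongGap : ℕ → Set
CofiniteStarWithLongGap n = ∃ λ (S : List Word) →
  All (λ u → length u ≤ n) S × CoFinite (Star S) ×
  ∃ λ (w : Word) → ¬ Star S w × ((κ *ℚ κ) *ℚ ℕ→ℚ (n ^ 4 * 2 ^ n) ≤ℚ ℕ→ℚ (length w * length w))

construction-has-long-gap : ∀ c → 1 ≤ c → CofiniteStarWithLongGap (Construction.n c)
construction-has-long-gap c 1≤c =
  S , S-lengths≤n , star-cofinite , witness , witness∉S* ,
  κ²-scaled-≤ (n ^ 4 * 2 ^ n) (length witness * length witness)
    (subst (λ k → n ^ 4 * k ≤ 1024 * (length witness * length witness)) (sym 2^n≡2*N*N)
    (quartic-exponential-bound {c} {N = N} n≤2*m (m≤3*c 1≤c) c*N*m≤length-witness))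
  where open Construction c

corollary24 : ∃ λ (c : ℚ) → Positive c ×
    (∀ (n : ℕ) → n % 2 ≡ 1 → 5 ≤ n →
      ∃ λ (S : List Word) →
        All (λ u → length u ≤ n) S ×
        CoFinite (Star S) ×
        ∃ λ (w : Word) → ¬ Star S w ×
          ((c *ℚ c) *ℚ ℕ→ℚ (n ^ 4 * 2 ^ n) ≤ℚ ℕ→ℚ (length w * length w)))
corollary24 = κ , κ-positive , λ n n-odd 5≤n →
  let e , n≡ = odd-form (n / 2) (trans (m≡m%n+[m/n]*n n 2) (cong (_+ n / 2 * 2) n-odd)) 5≤n
  in  subst CofiniteStarWithLongGap (sym n≡) (construction-has-long-gap (suc e) (s≤s z≤n))
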